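{- For every step $(S,e,T)$ of the Simpler Lazy Set algorithm (with $S$ normal) and every address $a$: if $a$ is removed at $S$ then $a$ is still removed at $T$.
   Context: Fix an infinite set $A$ of addresses containing distinguished addresses $\mathsf H,\mathsf T$, and a finite set of processes. A state $S$ consists of a finite set $\mathrm{Active}^S\subseteq A$ containing $\mathsf H,\mathsf T$; $\mathrm{Val}^S:\mathrm{Active}^S\to\mathbb N\cup\{ -1,\infty\}$ with $\mathrm{Val}(\mathsf H)=-1$, $\mathrm{Val}(\mathsf T)=\infty$, $\mathrm{Val}(a)\in\mathbb N$ otherwise; $\mathrm{Next}^S:\mathrm{Active}^S\setminus\{\mathsf T\}\to A$; and, for each process $p$, a program counter $PC_p\in\{0,1,2,3.1,3.2,3.3,3.4,3.5\}$, a parameter $x_p\in\mathbb N$, a status and an address variable $\mathrm{curr}_p$. $S$ is normal if for every active $a\neq\mathsf T$, $\mathrm{Next}^S(a)$ is active and $\mathrm{Val}(a)<\mathrm{Val}(\mathrm{Next}(a))$; then each active $a$ has a unique finite path $a,\mathrm{Next}(a),\dots$ to $\mathsf T$, and the path from $\mathsf H$ is the main branch. An address is removed at $S$ if it is active in $S$ but not on the main branch of $S$. Steps $(S,e,T)$ by a process $p$ (everything not mentioned is unchanged): invocation: $PC_p=0$ becomes $1$, $2$ or $3.1$ with $x_p$ set to some natural number; failure: $PC_p\in\{1,2\}$ becomes $0$ (status $f$); $\mathrm{AD}(x)$ ($x=x_p$, $PC_p=1\to0$): let $u$ be the main-branch address with $\mathrm{Val}(u)<x\le\mathrm{Val}(\mathrm{Next}(u))$;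 if $\mathrm{Val}(\mathrm{Next}(u))=x$ nothing else changes (status $1$); otherwise a new address $a\notin\mathrm{Active}^S$ is made active with $\mathrm{Val}^T(a)=x$, $\mathrm{Next}^T(u)=a$, $\mathrm{Next}^T(a)=\mathrm{Next}^S(u)$ (status $0$); $\mathrm{RM}(x)$ ($PC_p=2\to0$): if some main-branch address $d$ has value $x$, with main-branch predecessor $c$, then $\mathrm{Next}^T(c)=\mathrm{Next}^S(d)$ (status $1$), otherwise nothing else changes (status $0$); CONTAINS steps (lines $3.1$–$3.5$): they change only $PC_p$, $\mathrm{curr}_p$ (assignments $\mathrm{curr}_p:=\mathsf H$ or $\mathrm{curr}_p:=\mathrm{Next}(\mathrm{curr}_p)$) and the returned status, not $\mathrm{Active},\mathrm{Val},\mathrm{Next}$. -}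

module Defs where

open import Data.Nat using (ℕ; zero; suc; _<_)
open import Data.Fin using (Fin)
open import Data.List using (List)
open import Data.List.Membership.Propositional using (_∈_; _∉_)
open import Data.Product using (Σ; ∃; ∃-syntax; _×_; _,_)
open import Data.Sum using (_⊎_)
open import Relation.Binary.PropositionalEquality using (_≡_; _≢_)
open import Relation.Nullary using (¬_)

data XVal : Set where
  neg1 : XVal
  nat  : ℕ → XVal
  inf  : XVal

data _<v_ : XVal → XVal → Set where
  neg<nat : ∀ {m} → neg1 <v nat m
  neg<inf : neg1 <v inf
  nat<nat : ∀ {m k} → m < k → nat m <v nat k
  nat<inf : ∀ {m} → nat m <v inf

_≤v_ : XVal → XVal → Set
x ≤v y = x <v y ⊎ x ≡ y

data PCv : Set where
  pc0 pc1 pc2 pc31 pc32 pc33 pc34 pc35 : PCv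

data ContainsLine : PCv → Set where
  l31 : ContainsLine pc31
  l32 : ContainsLine pc32
  l33 : ContainsLine pc33
  l34 : ContainsLine pc34
  l35 : ContainsLine pc35

-- Returned status values: f, 0, 1 (plus any further values CONTAINS may return)
data Status : Set where
  sf s0 s1 sother : Status

Infinite : Set → Set
Infinite A = (l : List A) → ∃[ a ] (a ∉ l)

iter : {A : Set} → (A → A) → ℕ → A → A
iter f zero    x = x
iter f (suc k) x = f (iter f k x)

module _ (A : Set) where
  record Local : Set where
    field
      pc     : PCv
      arg    : ℕ
      status : Status
      curr   : A

module _ (A : Set) (hd tl : A) (n : ℕ) where

  -- A state. Val and Next are total functions on A, but only their values on
  -- Active (resp. Active ∖ {tl}) are meaningful; steps constrain only those.
  record State : Set where
    field
      Active : List A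
      Val    : A → XVal
      Next   : A → A
      loc    : Fin n → Local A
      hd∈    : hd ∈ Active
      tl∈    : tl ∈ Active
      valHd  : Val hd ≡ neg1
      valTl  : Val tl ≡ inf
      valNat : ∀ a → a ∈ Active → a ≢ hd → a ≢ tl → ∃[ m ] (Val a ≡ nat m)

  open State

  Normal : State → Set
  Normal S = ∀ a → a ∈ Active S → a ≢ tl →
               (Next S a ∈ Active S) × (Val S a <v Val S (Next S a))

  OnMain : State → A → Set
  OnMain S a = ∃[ k ] ((iter (Next S) k hd ≡ a) ×
                       (∀ j → j < k → iter (Next S) j hd ≢ tl))

  Removed : State → A → Set
  Removed S a = (a ∈ Active S) × ¬ OnMain S a

  HeapSame : State → State → Set
  HeapSame S T = (∀ x → (x ∈ Active S → x ∈ Active T) × (x ∈ Active T → x ∈ Active S))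
               × (∀ x → x ∈ Active S → Val T x ≡ Val S x)
               × (∀ x → x ∈ Active S → x ≢ tl → Next T x ≡ Next S x)

  OthersSame : Fin n → State → State → Set
  OthersSame p S T = ∀ q → q ≢ p → loc T q ≡ loc S q

  data Event : Set where
    invoke   : Fin n → PCv → ℕ → Event
    fail     : Fin n → Event
    add      : Fin n → Event
    rm       : Fin n → Event
    contains : Fin n → Event

  data InvTarget : PCv → Set where
    to1  : InvTarget pc1
    to2  : InvTarget pc2
    to31 : InvTarget pc31

  data Step : State → Event → State → Set where
    invocation : ∀ {S T p pc' x} →
      Local.pc (loc S p) ≡ pc0 → InvTarget pc' →
      loc T p ≡ record (loc S p) { pc = pc' ; arg = x } →
      OthersSame p S T → HeapSame S T →
      Step S (invoke p pc' x) T
    failure : ∀ {S T p} →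
      (Local.pc (loc S p) ≡ pc1 ⊎ Local.pc (loc S p) ≡ pc2) →
      loc T p ≡ record (loc S p) { pc = pc0 ; status = sf } →
      OthersSame p S T → HeapSame S T →
      Step S (fail p) T
    add-present : ∀ {S T p} (u : A) →
      Local.pc (loc S p) ≡ pc1 →
      OnMain S u →
      Val S u <v nat (Local.arg (loc S p)) →
      Val S (Next S u) ≡ nat (Local.arg (loc S p)) →
      loc T p ≡ record (loc S p) { pc = pc0 ; status = s1 } →
      OthersSame p S T → HeapSame S T →
      Step S (add p) T
    add-new : ∀ {S T p} (u a : A) →
      Local.pc (loc S p) ≡ pc1 →
      OnMain S u →
      Val S u <v nat (Local.arg (loc S p)) →
      nat (Local.arg (loc S p)) ≤v Val S (Next S u) →
      Val S (Next S u) ≢ nat (Local.arg (loc S p)) →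
      a ∉ Active S →
      (∀ x → (x ∈ Active T → x ≡ a ⊎ x ∈ Active S) × (x ≡ a ⊎ x ∈ Active S → x ∈ Active T)) →
      Val T a ≡ nat (Local.arg (loc S p)) →
      (∀ x → x ∈ Active S → Val T x ≡ Val S x) →
      Next T u ≡ a →
      Next T a ≡ Next S u →
      (∀ x → x ∈ Active S → x ≢ tl → x ≢ u → Next T x ≡ Next S x) →
      loc T p ≡ record (loc S p) { pc = pc0 ; status = s0 } →
      OthersSame p S T →
      Step S (add p) T
    rm-found : ∀ {S T p} (c d : A) →
      Local.pc (loc S p) ≡ pc2 →
      OnMain S d → Val S d ≡ nat (Local.arg (loc S p)) →
      OnMain S c → c ≢ tl → Next S c ≡ d →
      (∀ x → (x ∈ Active S → x ∈ Active T) × (x ∈ Active T → x ∈ Active S)) →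
      (∀ x → x ∈ Active S → Val T x ≡ Val S x) →
      Next T c ≡ Next S d →
      (∀ x → x ∈ Active S → x ≢ tl → x ≢ c → Next T x ≡ Next S x) →
      loc T p ≡ record (loc S p) { pc = pc0 ; status = s1 } →
      OthersSame p S T →
      Step S (rm p) T
    rm-absent : ∀ {S T p} →
      Local.pc (loc S p) ≡ pc2 →
      ¬ (∃[ d ] (OnMain S d × (Val S d ≡ nat (Local.arg (loc S p))))) →
      loc T p ≡ record (loc S p) { pc = pc0 ; status = s0 } →
      OthersSame p S T → HeapSame S T →
      Step S (rm p) T
    contains-step : ∀ {S T p} →
      ContainsLine (Local.pc (loc S p)) →
      (Local.curr (loc T p) ≡ hd ⊎ Local.curr (loc T p) ≡ Next S (Local.curr (loc S p))
        ⊎ Local.curr (loc T p) ≡ Local.curr (loc S p)) →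
      Local.arg (loc T p) ≡ Local.arg (loc S p) →
      OthersSame p S T → HeapSame S T →
      Step S (contains p) T

module Submission where

open import Defs
open import Data.Nat using (ℕ; zero; suc; _<_)
open import Data.Nat.Properties using (m<n⇒m<1+n; n<1+n; m<1+n⇒m<n∨m≡n)
open import Function using (id)
open import Data.Product using (_,_; proj₁; proj₂)
open import Data.Sum using (_⊎_; inj₁; inj₂; [_,_])
open import Data.List.Membership.Propositional using (_∈_)
open import Relation.Nullary using (¬_; Dec; yes; no; contradiction)
open import Relation.Nullary.Decidable.Core using (¬¬-excluded-middle)
open import Relation.Nullary.Negation.Core using (¬¬-map; negated-stable)
open import Relation.Binary.PropositionalEquality using (_≡_; _≢_; refl; sym; trans; subst)

-- A step only redirects the Next pointer of one main-branch address c: to a fresh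
-- address whose successor is the old Next c (AD), or past the old Next c (RM).
-- Hence every address on the new main branch is either fresh or was already on
-- the old one, so removed addresses stay removed.  Equality of addresses is not
-- decidable, so the case split "is this c?" is done under a double negation,
-- which suffices because "not on the main branch" is a negative statement.

iter-invariant : {A : Set} (f : A → A) (stop : A) (G : A → Set) {x : A} → G x →
                 (∀ y → G y → y ≢ stop → G (f y)) →
                 ∀ k → (∀ j → j < k → iter f j x ≢ stop) → G (iter f k x)
iter-invariant f stop G gx step zero    _      = gx
iter-invariant f stop G gx step (suc k) before =
  step _ (iter-invariant f stop G gx step k (λ j j<k → before j (m<n⇒m<1+n j<k)))
         (before k (n<1+n k))

module _ {A : Set} {hd tl : A} {n : ℕ} where
  open State

  private
    Main : State A hd tl n → A → Set
    Main = OnMain A hd tl n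

  onMain-hd : (S : State A hd tl n) → Main S hd
  onMain-hd S = 0 , refl , λ _ ()

  onMain-Next : (S : State A hd tl n) {y : A} → Main S y → y ≢ tl → Main S (Next S y)
  onMain-Next S (k , refl , before) y≢tl = suc k , refl , before′
    where
    before′ : ∀ j → j < suc k → iter (Next S) j hd ≢ tl
    before′ j j<1+k with m<1+n⇒m<n∨m≡n j<1+k
    ... | inj₁ j<k  = before j j<k
    ... | inj₂ refl = y≢tl

  onMain-invariant : (S : State A hd tl n) (G : A → Set) → G hd →
                     (∀ y → G y → y ≢ tl → G (Next S y)) → ∀ {x} → Main S x → G x
  onMain-invariant S G ghd step (k , refl , before) =
    iter-invariant (Next S) tl G ghd step k before

  onMain-¬¬invariant : (S : State A hd tl n) (G : A → Set) → G hd →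
                       (∀ y → G y → y ≢ tl → ¬ ¬ G (Next S y)) → ∀ {x} → Main S x → ¬ ¬ G x
  onMain-¬¬invariant S G ghd step =
    onMain-invariant S (λ x → ¬ ¬ G x) (λ ¬ghd → ¬ghd ghd)
      (λ y ¬¬gy y≢tl → negated-stable (¬¬-map (λ gy → step y gy y≢tl) ¬¬gy))

  onMain⇒active : (S : State A hd tl n) → Normal A hd tl n S → ∀ {x} → Main S x → x ∈ Active S
  onMain⇒active S normal =
    onMain-invariant S (_∈ Active S) (hd∈ S) (λ y y∈ y≢tl → proj₁ (normal y y∈ y≢tl))

  nat-valued⇒≢tl : (S : State A hd tl n) {d : A} {m : ℕ} → Val S d ≡ nat m → d ≢ tl
  nat-valued⇒≢tl S vd refl with trans (sym vd) (valTl S)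
  ... | ()

  below-nat⇒≢tl : (S : State A hd tl n) {u : A} {m : ℕ} → Val S u <v nat m → u ≢ tl
  below-nat⇒≢tl S u<m refl with subst (_<v _) (valTl S) u<m
  ... | ()

  onMain-Next-redirected : (S T : State A hd tl n) (c : A) → Normal A hd tl n S →
    (∀ y → y ∈ Active S → y ≢ tl → y ≢ c → Next T y ≡ Next S y) →
    ∀ {y} → Main S y → y ≢ tl → ¬ ¬ (y ≡ c ⊎ Main S (Next T y))
  onMain-Next-redirected S T c normal agree {y} y∈main y≢tl =
    ¬¬-map case-on-c ¬¬-excluded-middle
    where
    case-on-c : Dec (y ≡ c) → y ≡ c ⊎ Main S (Next T y)
    case-on-c (yes y≡c) = inj₁ y≡c
    case-on-c (no  y≢c) =
      inj₂ (subst (Main S) (sym (agree y (onMain⇒active S normal y∈main) y≢tl y≢c))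
                  (onMain-Next S y∈main y≢tl))

  heapSame⇒onMain : (S T : State A hd tl n) → Normal A hd tl n S → HeapSame A hd tl n S T →
                    ∀ {x} → Main T x → Main S x
  heapSame⇒onMain S T normal (_ , _ , agree) =
    onMain-invariant T (Main S) (onMain-hd S)
      (λ y y∈main y≢tl → subst (Main S) (sym (agree y (onMain⇒active S normal y∈main) y≢tl))
                                (onMain-Next S y∈main y≢tl))

  step-preserves-active : (S T : State A hd tl n) {e : Event A hd tl n} → Step A hd tl n S e T →
                          ∀ {x} → x ∈ Active S → x ∈ Active T
  step-preserves-active S T (invocation _ _ _ _ (act , _)) = proj₁ (act _)
  step-preserves-active S T (failure _ _ _ (act , _))      = proj₁ (act _)
  step-preserves-active S T (add-present _ _ _ _ _ _ _ (act , _)) = proj₁ (act _)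
  step-preserves-active S T (add-new _ _ _ _ _ _ _ _ act _ _ _ _ _ _ _) x∈ = proj₂ (act _) (inj₂ x∈)
  step-preserves-active S T (rm-found _ _ _ _ _ _ _ _ act _ _ _ _ _) = proj₁ (act _)
  step-preserves-active S T (rm-absent _ _ _ _ (act , _))   = proj₁ (act _)
  step-preserves-active S T (contains-step _ _ _ _ (act , _)) = proj₁ (act _)

  step-onMain : (S T : State A hd tl n) {e : Event A hd tl n} → Normal A hd tl n S →
                Step A hd tl n S e T → ∀ {x} → Main T x → x ∈ Active S → ¬ ¬ Main S x
  step-onMain S T normal (invocation _ _ _ _ same) x∈main _ ¬x∈main =
    ¬x∈main (heapSame⇒onMain S T normal same x∈main)
  step-onMain S T normal (failure _ _ _ same) x∈main _ ¬x∈main =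
    ¬x∈main (heapSame⇒onMain S T normal same x∈main)
  step-onMain S T normal (add-present _ _ _ _ _ _ _ same) x∈main _ ¬x∈main =
    ¬x∈main (heapSame⇒onMain S T normal same x∈main)
  step-onMain S T normal (rm-absent _ _ _ _ same) x∈main _ ¬x∈main =
    ¬x∈main (heapSame⇒onMain S T normal same x∈main)
  step-onMain S T normal (contains-step _ _ _ _ same) x∈main _ ¬x∈main =
    ¬x∈main (heapSame⇒onMain S T normal same x∈main)
  step-onMain S T normal (add-new u new _ u∈main u<x _ _ new∉ _ _ _ u↦new new↦ agree _ _) x∈main x∈ =
    ¬¬-map [ (λ { refl → contradiction x∈ new∉ }) , id ]
      (onMain-¬¬invariant T FreshOrOld (inj₂ (onMain-hd S)) step x∈main)
    where
    FreshOrOld : A → Set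
    FreshOrOld y = y ≡ new ⊎ Main S y
    step : ∀ y → FreshOrOld y → y ≢ tl → ¬ ¬ FreshOrOld (Next T y)
    step y (inj₁ refl) _ ¬old =
      ¬old (inj₂ (subst (Main S) (sym new↦) (onMain-Next S u∈main (below-nat⇒≢tl S u<x))))
    step y (inj₂ y∈main) y≢tl =
      ¬¬-map [ (λ { refl → inj₁ u↦new }) , inj₂ ]
        (onMain-Next-redirected S T u normal agree y∈main y≢tl)
  step-onMain S T normal (rm-found c d _ d∈main vd _ _ _ _ _ c↦ agree _ _) x∈main _ =
    onMain-¬¬invariant T (Main S) (onMain-hd S) step x∈main
    where
    d↦∈main : Main S (Next S d)
    d↦∈main = onMain-Next S d∈main (nat-valued⇒≢tl S vd)
    step : ∀ y → Main S y → y ≢ tl → ¬ ¬ Main S (Next T y)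
    step y y∈main y≢tl =
      ¬¬-map [ (λ { refl → subst (Main S) (sym c↦) d↦∈main }) , id ]
        (onMain-Next-redirected S T c normal agree y∈main y≢tl)

lemma4p7 : (A : Set) (hd tl : A) → hd ≢ tl → Infinite A → (n : ℕ) →
             (S T : State A hd tl n) (e : Event A hd tl n) (a : A) →
             Normal A hd tl n S → Step A hd tl n S e T →
             Removed A hd tl n S a → Removed A hd tl n T a
lemma4p7 A hd tl _ _ n S T e a normal step (a∈ , a∉main) =
  step-preserves-active S T step a∈ ,
  λ a∈main → step-onMain S T normal step a∈main a∈ a∉main
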